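{- If $G=(V,E)$ is a word-representable graph, then there exists a border-free word $w$ that represents $G$.
   Context: For a word $w$ and a set $S$ of letters, $w_S$ denotes the word obtained from $w$ by deleting all letters not in $S$. Two distinct letters $x,y$ alternate in a word $w$ if $w_{\{x,y\}}$ is of the form $xyxy\cdots$ or $yxyx\cdots$ (of even or odd length). A simple graph $G=(V,E)$ is word-representable if there exists a word $w$ over the alphabet $V$, containing every vertex at least once, such that two distinct letters $x,y$ alternate in $w$ if and only if $xy\in E$; such $w$ is said to represent $G$. A word $w$ is bordered if $w=uvu$ for some words $u,v$ with $u$ non-empty; otherwise it is border-free. -}

module Defs where

open import Data.Nat using (ℕ)
open import Data.Fin using (Fin; _≟_)
open import Data.List using (List; []; _∷_; _++_; filter)
open import Data.List.Membership.Propositional using (_∈_)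
open import Data.Sum using (_⊎_)
open import Data.Product using (_×_; ∃; ∃₂)
open import Relation.Nullary using (¬_)
open import Relation.Nullary.Decidable using (_⊎-dec_)
open import Relation.Binary.PropositionalEquality using (_≡_; _≢_)

record Graph (n : ℕ) : Set₁ where
  field
    Edge    : Fin n → Fin n → Set
    sym     : ∀ {x y} → Edge x y → Edge y x
    irrefl  : ∀ {x} → ¬ Edge x x

Word : ℕ → Set
Word n = List (Fin n)

restrict : ∀ {n} → Fin n → Fin n → Word n → Word n
restrict x y = filter (λ z → (z ≟ x) ⊎-dec (z ≟ y))

-- a word in which no two consecutive letters are equal; on a word over {x,y}
-- this is exactly the form xyxy... or yxyx...
data NoRepeat {n} : Word n → Set where
  nr-[]  : NoRepeat []
  nr-[_] : ∀ a → NoRepeat (a ∷ [])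
  nr-∷   : ∀ {a b w} → a ≢ b → NoRepeat (b ∷ w) → NoRepeat (a ∷ b ∷ w)

Alternate : ∀ {n} → Fin n → Fin n → Word n → Set
Alternate x y w = x ≢ y × NoRepeat (restrict x y w)

Represents : ∀ {n} → Graph n → Word n → Set
Represents {n} G w =
  (∀ (x : Fin n) → x ∈ w) ×
  (∀ (x y : Fin n) → x ≢ y → (Alternate x y w → Graph.Edge G x y) × (Graph.Edge G x y → Alternate x y w))

WordRepresentable : ∀ {n} → Graph n → Set
WordRepresentable G = ∃ λ w → Represents G w

Bordered : ∀ {n} → Word n → Set
Bordered w = ∃₂ λ u v → u ≢ [] × w ≡ u ++ v ++ u

BorderFree : ∀ {n} → Word n → Set
BorderFree w = ¬ Bordered w

module Submission where

-- Pad a representing word until every letter occurs equally often. In such a uniform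
-- word two letters alternate exactly when their restriction is (ab)^k, and this is
-- preserved by cyclic rotation and by passing to a root, so every rotation and the
-- primitive root of a uniform representant represent the graph too. The
-- lexicographically least rotation of a primitive word is a Lyndon word, and Lyndon
-- words are border-free.

open import Defs
open import Data.Empty using (⊥-elim)
open import Data.Fin using (Fin; _≟_; punchIn)
open import Data.Fin.Properties using (any?; punchInᵢ≢i; <-strictTotalOrder; <-irrefl)
open import Data.List using (List; []; _∷_; _++_; [_]; length; filter; upTo; take; drop)
open import Data.List.Properties using (++-assoc; ++-identityʳ; ++-cancelˡ; ∷-injective; length-++; length-++-comm; length-take; length-drop; take++drop≡id; filter-++; filter-accept; filter-reject; filter-≐; length-filter; ≡-dec)
open import Data.List.Membership.Propositional using (_∈_)
open import Data.List.Membership.Propositional.Properties using (∈-++⁻; ∈-upTo⁺)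
open import Data.List.Relation.Binary.Lex.Core using (base; halt; this; next)
open import Data.List.Relation.Binary.Lex.Strict using (≤-decTotalOrder)
open import Data.List.Relation.Binary.Permutation.Propositional using (_↭_; ↭-refl; ↭-trans; ↭-sym)
open import Data.List.Relation.Binary.Permutation.Propositional.Properties using (↭-length; filter-↭; ∈-resp-↭; ∷↭∷ʳ)
open import Data.List.Relation.Binary.Pointwise using (Pointwise-≡⇒≡)
open import Data.List.Relation.Unary.All as All using (All; _∷_)
open import Data.List.Relation.Unary.All.Properties using (all-filter)
open import Data.List.Relation.Unary.Any using (there; tail)
import Data.List.Extrema
open import Data.Nat using (ℕ; zero; suc; _+_; _*_; _∸_; _≤_; _<_; _≤?_; _<?_; z≤n; s≤s; NonZero)
open import Data.Nat.DivMod using (_%_; _/_; m≡m%n+[m/n]*n; m%n<n)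
open import Data.Nat.Induction using (<-wellFounded)
open import Data.Nat.Properties using (+-0-commutativeMonoid; suc-injective; +-comm; +-suc; +-identityʳ; *-identityʳ; *-cancelˡ-≡; +-∸-assoc; +-monoʳ-<; +-monoˡ-<; m<n+m; m≤m+n; m<m+n; n≤1+n; 1+n≢n; ≤-refl; ≤-reflexive; ≤-trans; ≤-antisym; ≤-<-trans; <-≤-trans; <⇒≤; <⇒≱; ≰⇒>; ≮⇒≥; m≤n⇒m⊓n≡m; m>n⇒m∸n≢0; anyUpTo?)
open import Data.Product using (Σ; ∃; ∃₂; _×_; _,_; proj₁; proj₂)
open import Data.Sum as Sum using (_⊎_; inj₁; inj₂)
open import Data.Unit using (tt)
open import Function using (_∘_)
open import Induction.WellFounded using (Acc; acc)
open import Relation.Binary.Bundles using (DecTotalOrder)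
open import Relation.Binary.PropositionalEquality hiding ([_])
open import Relation.Nullary using (¬_; Dec; yes; no; ¬?)
open import Relation.Nullary.Decidable using (_⊎-dec_; _×-dec_)
open import Relation.Unary using (Pred; Decidable; _⊆_)
open import Algebra.Properties.CommutativeMonoid.Sum +-0-commutativeMonoid using (sum; sum-remove; sum-cong-≗)


module _ {a} {A : Set a} where

  infixr 8 _^_
  _^_ : List A → ℕ → List A
  u ^ zero  = []
  u ^ suc m = u ++ u ^ m

  ^-+ : ∀ u i j → u ^ (i + j) ≡ u ^ i ++ u ^ j
  ^-+ u zero    j = refl
  ^-+ u (suc i) j = trans (cong (u ++_) (^-+ u i j)) (sym (++-assoc u (u ^ i) (u ^ j)))

  ^-* : ∀ u i j → (u ^ i) ^ j ≡ u ^ (j * i)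
  ^-* u i zero    = refl
  ^-* u i (suc j) = trans (cong (u ^ i ++_) (^-* u i j)) (sym (^-+ u i (j * i)))

  ∈-^ : ∀ {x} u m → x ∈ u ^ m → x ∈ u
  ∈-^ u (suc m) x∈ with ∈-++⁻ u x∈
  ... | inj₁ x∈u  = x∈u
  ... | inj₂ x∈uᵐ = ∈-^ u m x∈uᵐ

  rotate₁ : List A → List A
  rotate₁ []       = []
  rotate₁ (x ∷ xs) = xs ++ [ x ]

  rotate : ℕ → List A → List A
  rotate zero    w = w
  rotate (suc k) w = rotate k (rotate₁ w)

  rotate-+ : ∀ i j w → rotate (i + j) w ≡ rotate j (rotate i w)
  rotate-+ zero    j w = refl
  rotate-+ (suc i) j w = rotate-+ i j (rotate₁ w)

  rotate-++ : ∀ u v → rotate (length u) (u ++ v) ≡ v ++ u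
  rotate-++ []      v = sym (++-identityʳ v)
  rotate-++ (x ∷ u) v = begin
    rotate (length u) ((u ++ v) ++ [ x ]) ≡⟨ cong (rotate (length u)) (++-assoc u v [ x ]) ⟩
    rotate (length u) (u ++ v ++ [ x ])   ≡⟨ rotate-++ u (v ++ [ x ]) ⟩
    (v ++ [ x ]) ++ u                     ≡⟨ ++-assoc v [ x ] u ⟩
    v ++ x ∷ u                            ∎
    where open ≡-Reasoning

  rotate-length : ∀ w → rotate (length w) w ≡ w
  rotate-length w = trans (cong (rotate (length w)) (sym (++-identityʳ w))) (rotate-++ w [])

  rotate-*length : ∀ q w → rotate (q * length w) w ≡ w
  rotate-*length zero    w = refl
  rotate-*length (suc q) w = begin
    rotate (length w + q * length w) w          ≡⟨ rotate-+ (length w) (q * length w) w ⟩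
    rotate (q * length w) (rotate (length w) w) ≡⟨ cong (rotate (q * length w)) (rotate-length w) ⟩
    rotate (q * length w) w                     ≡⟨ rotate-*length q w ⟩
    w                                           ∎
    where open ≡-Reasoning

  rotate-% : ∀ j w .{{_ : NonZero (length w)}} → rotate j w ≡ rotate (j % length w) w
  rotate-% j w = begin
    rotate j w                        ≡⟨ cong (λ k → rotate k w) j≡qL+r ⟩
    rotate (q * L + j % L) w          ≡⟨ rotate-+ (q * L) (j % L) w ⟩
    rotate (j % L) (rotate (q * L) w) ≡⟨ cong (rotate (j % L)) (rotate-*length q w) ⟩
    rotate (j % L) w                  ∎
    where
    open ≡-Reasoning
    L = length w
    q = j / L
    j≡qL+r : j ≡ q * L + j % L
    j≡qL+r = trans (m≡m%n+[m/n]*n j L) (+-comm (j % L) (q * L))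

  rotate-↭ : ∀ k w → rotate k w ↭ w
  rotate-↭ zero    w        = ↭-refl
  rotate-↭ (suc k) []       = rotate-↭ k []
  rotate-↭ (suc k) (x ∷ xs) = ↭-trans (rotate-↭ k (xs ++ [ x ])) (↭-sym (∷↭∷ʳ x xs))

  ++-prefix : ∀ (x y u v : List A) → x ++ y ≡ u ++ v → length x ≤ length u → ∃ λ t → u ≡ x ++ t
  ++-prefix []      y u       v e _ = u , refl
  ++-prefix (c ∷ x) y (d ∷ u) v e (s≤s |x|≤|u|) with ∷-injective e
  ... | refl , e′ with t , refl ← ++-prefix x y u v e′ |x|≤|u| = t , refl

  ≢[]⇒0<length : ∀ (u : List A) → u ≢ [] → 0 < length u
  ≢[]⇒0<length []      u≢[] = ⊥-elim (u≢[] refl)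
  ≢[]⇒0<length (_ ∷ _) _    = s≤s z≤n

  ++-comm-residual : ∀ (u : List A) {v} t → u ++ v ≡ v ++ u → v ≡ u ++ t → u ++ t ≡ t ++ u
  ++-comm-residual u {v} t uv≡vu v≡ut = ++-cancelˡ u (u ++ t) (t ++ u) (begin
    u ++ u ++ t   ≡⟨ cong (u ++_) v≡ut ⟨
    u ++ v        ≡⟨ uv≡vu ⟩
    v ++ u        ≡⟨ cong (_++ u) v≡ut ⟩
    (u ++ t) ++ u ≡⟨ ++-assoc u t u ⟩
    u ++ t ++ u   ∎)
    where open ≡-Reasoning

  residual-shorter : ∀ (u : List A) {v} t → v ≡ u ++ t → u ≢ [] → length t < length v
  residual-shorter u t refl u≢[] =
    subst (length t <_) (sym (length-++ u)) (m<n+m (length t) (≢[]⇒0<length u u≢[]))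

  ++-comm⇒^ : ∀ u v → u ++ v ≡ v ++ u → u ≢ [] → ∃₂ λ z i → ∃ λ j → u ≡ z ^ suc i × v ≡ z ^ j
  ++-comm⇒^ u v = go u v (<-wellFounded (length u + length v))
    where
    go : ∀ u v → Acc _<_ (length u + length v) → u ++ v ≡ v ++ u → u ≢ [] →
         ∃₂ λ z i → ∃ λ j → u ≡ z ^ suc i × v ≡ z ^ j
    go u [] _ _ _ = u , 0 , 0 , sym (++-identityʳ u) , refl
    go u v@(_ ∷ _) (acc rec) uv≡vu u≢[] with length u ≤? length v
    ... | yes |u|≤|v|
      with t , v≡ut ← ++-prefix u v v u uv≡vu |u|≤|v|
      with z , i , j , u≡zⁱ⁺¹ , t≡zʲ ← go u t (rec (+-monoʳ-< (length u) (residual-shorter u t v≡ut u≢[])))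
                                          (++-comm-residual u t uv≡vu v≡ut) u≢[]
      = z , i , suc i + j , u≡zⁱ⁺¹ , trans v≡ut (trans (cong₂ _++_ u≡zⁱ⁺¹ t≡zʲ) (sym (^-+ z (suc i) j)))
    ... | no |u|≰|v|
      with t , u≡vt ← ++-prefix v u u v (sym uv≡vu) (<⇒≤ (≰⇒> |u|≰|v|))
      with z , i , j , t≡zⁱ⁺¹ , v≡zʲ ← go t v (rec (+-monoˡ-< (length v) (residual-shorter v t u≡vt (λ ()))))
                                          (sym (++-comm-residual v t (sym uv≡vu) u≡vt))
                                          (λ { refl → |u|≰|v| (≤-reflexive (cong length
                                                                  (trans u≡vt (++-identityʳ v)))) })
      = z , j + i , j ,
        trans u≡vt (trans (cong₂ _++_ v≡zʲ t≡zⁱ⁺¹) (trans (sym (^-+ z j (suc i))) (cong (z ^_) (+-suc j i)))) ,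
        v≡zʲ

filter-⊆ : ∀ {a p q} {A : Set a} {P : Pred A p} {Q : Pred A q} (P? : Decidable P) (Q? : Decidable Q) →
           P ⊆ Q → ∀ w → filter P? (filter Q? w) ≡ filter P? w
filter-⊆ P? Q? P⊆Q [] = refl
filter-⊆ P? Q? P⊆Q (z ∷ w) with Q? z
... | no ¬qz = trans (filter-⊆ P? Q? P⊆Q w) (sym (filter-reject P? (¬qz ∘ P⊆Q)))
... | yes _ with P? z
...   | yes _ = cong (z ∷_) (filter-⊆ P? Q? P⊆Q w)
...   | no  _ = filter-⊆ P? Q? P⊆Q w

sum-suc-at : ∀ {m} (f g : Fin m → ℕ) i → f i ≡ suc (g i) → (∀ j → j ≢ i → f j ≡ g j) →
             sum f ≡ suc (sum g)
sum-suc-at {suc m} f g i fi≡ f≗g = begin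
  sum f                           ≡⟨ sum-remove f ⟩
  f i + sum (f ∘ punchIn i)       ≡⟨ cong₂ _+_ fi≡ (sum-cong-≗ (λ j → f≗g (punchIn i j) (punchInᵢ≢i i j))) ⟩
  suc (g i + sum (g ∘ punchIn i)) ≡⟨ cong suc (sum-remove g) ⟨
  suc (sum g)                     ∎
  where open ≡-Reasoning

module _ {n : ℕ} where

  count : Fin n → Word n → ℕ
  count x w = length (filter (_≟ x) w)

  count-++ : ∀ x u v → count x (u ++ v) ≡ count x u + count x v
  count-++ x u v = trans (cong length (filter-++ (_≟ x) u v)) (length-++ (filter (_≟ x) u))

  count-∷-self : ∀ x w → count x (x ∷ w) ≡ suc (count x w)
  count-∷-self x w = cong length (filter-accept (_≟ x) refl)

  count-∷-other : ∀ {x z : Fin n} w → z ≢ x → count x (z ∷ w) ≡ count x w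
  count-∷-other w z≢x = cong length (filter-reject (_≟ _) z≢x)

  count-^ : ∀ x u m → count x (u ^ m) ≡ m * count x u
  count-^ x u zero    = refl
  count-^ x u (suc m) = trans (count-++ x u (u ^ m)) (cong (count x u +_) (count-^ x u m))

  count-↭ : ∀ x {u v} → u ↭ v → count x u ≡ count x v
  count-↭ x u↭v = ↭-length (filter-↭ (_≟ x) u↭v)

  Uniform : Word n → Set
  Uniform w = ∀ x y → count x w ≡ count y w

  restrict-++ : ∀ (x y : Fin n) u v → restrict x y (u ++ v) ≡ restrict x y u ++ restrict x y v
  restrict-++ x y = filter-++ (λ z → (z ≟ x) ⊎-dec (z ≟ y))

  restrict-accept : ∀ {x y z : Fin n} w → z ≡ x ⊎ z ≡ y → restrict x y (z ∷ w) ≡ z ∷ restrict x y w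
  restrict-accept w = filter-accept (λ z → (z ≟ _) ⊎-dec (z ≟ _))

  restrict-reject : ∀ {x y z : Fin n} w → ¬ (z ≡ x ⊎ z ≡ y) → restrict x y (z ∷ w) ≡ restrict x y w
  restrict-reject w = filter-reject (λ z → (z ≟ _) ⊎-dec (z ≟ _))

  restrict-comm : ∀ (x y : Fin n) w → restrict x y w ≡ restrict y x w
  restrict-comm x y =
    filter-≐ (λ z → (z ≟ x) ⊎-dec (z ≟ y)) (λ z → (z ≟ y) ⊎-dec (z ≟ x)) (Sum.swap , Sum.swap)

  restrict-^ : ∀ (x y : Fin n) u m → restrict x y (u ^ m) ≡ restrict x y u ^ m
  restrict-^ x y u zero    = refl
  restrict-^ x y u (suc m) = trans (restrict-++ x y u (u ^ m)) (cong (restrict x y u ++_) (restrict-^ x y u m))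

  restrict-rotate₁ : ∀ (x y : Fin n) w →
                     restrict x y (rotate₁ w) ≡ rotate₁ (restrict x y w) ⊎ restrict x y (rotate₁ w) ≡ restrict x y w
  restrict-rotate₁ x y []      = inj₁ refl
  restrict-rotate₁ x y (z ∷ w) with (z ≟ x) ⊎-dec (z ≟ y)
  ... | yes z∈ = inj₁ (begin
    restrict x y (w ++ [ z ])          ≡⟨ restrict-++ x y w [ z ] ⟩
    restrict x y w ++ restrict x y [ z ] ≡⟨ cong (restrict x y w ++_) (restrict-accept [] z∈) ⟩
    rotate₁ (z ∷ restrict x y w)       ≡⟨ cong rotate₁ (restrict-accept w z∈) ⟨
    rotate₁ (restrict x y (z ∷ w))     ∎)
    where open ≡-Reasoning
  ... | no z∉ = inj₂ (begin
    restrict x y (w ++ [ z ])          ≡⟨ restrict-++ x y w [ z ] ⟩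
    restrict x y w ++ restrict x y [ z ] ≡⟨ cong (restrict x y w ++_) (restrict-reject [] z∉) ⟩
    restrict x y w ++ []               ≡⟨ ++-identityʳ (restrict x y w) ⟩
    restrict x y w                     ≡⟨ restrict-reject w z∉ ⟨
    restrict x y (z ∷ w)               ∎)
    where open ≡-Reasoning

  Binary : Fin n → Fin n → Word n → Set
  Binary a b = All (λ z → z ≡ a ⊎ z ≡ b)

  StartsWith : Fin n → Word n → Set
  StartsWith y s = ∃ λ t → s ≡ y ∷ t

  binary-restrict : ∀ (x y : Fin n) w → Binary x y (restrict x y w)
  binary-restrict x y = all-filter (λ z → (z ≟ x) ⊎-dec (z ≟ y))

  count-restrict : ∀ {x p q : Fin n} w → x ≡ p ⊎ x ≡ q → count x (restrict p q w) ≡ count x w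
  count-restrict {x} {p} {q} w x∈ =
    cong length (filter-⊆ (_≟ x) (λ z → (z ≟ p) ⊎-dec (z ≟ q)) (λ { refl → x∈ }) w)

  noRepeat-tail : ∀ {a : Fin n} {s} → NoRepeat (a ∷ s) → NoRepeat s
  noRepeat-tail nr-[ _ ]    = nr-[]
  noRepeat-tail (nr-∷ _ nr) = nr

  noRepeat-++ˡ : ∀ (s : Word n) {t} → NoRepeat (s ++ t) → NoRepeat s
  noRepeat-++ˡ []          nr          = nr-[]
  noRepeat-++ˡ (a ∷ [])    nr          = nr-[ a ]
  noRepeat-++ˡ (a ∷ b ∷ s) (nr-∷ a≢b nr) = nr-∷ a≢b (noRepeat-++ˡ (b ∷ s) nr)

  alternation-shape : ∀ {a b : Fin n} t → Binary a b (a ∷ t) → NoRepeat (a ∷ t) →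
                      ∃ λ j → a ∷ t ≡ (a ∷ b ∷ []) ^ j ++ [ a ] ⊎ a ∷ t ≡ (a ∷ b ∷ []) ^ suc j
  alternation-shape []      _ _ = 0 , inj₁ refl
  alternation-shape (_ ∷ _) (_ ∷ inj₁ refl ∷ _) (nr-∷ a≢a _) = ⊥-elim (a≢a refl)
  alternation-shape (_ ∷ []) (_ ∷ inj₂ refl ∷ _) _ = 0 , inj₂ refl
  alternation-shape (_ ∷ _ ∷ _) (_ ∷ inj₂ refl ∷ inj₂ refl ∷ _) (nr-∷ _ (nr-∷ b≢b _)) = ⊥-elim (b≢b refl)
  alternation-shape {a} {b} (_ ∷ _ ∷ t) (_ ∷ inj₂ refl ∷ bin@(inj₁ refl ∷ _)) (nr-∷ _ (nr-∷ _ nr))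
    with j , shape ← alternation-shape t bin nr
    = suc j , Sum.map (cong (λ s → a ∷ b ∷ s)) (cong (λ s → a ∷ b ∷ s)) shape

  count-pair : ∀ {a b : Fin n} → a ≢ b → count a (a ∷ b ∷ []) ≡ 1 × count b (a ∷ b ∷ []) ≡ 1
  count-pair {a} {b} a≢b =
    trans (count-∷-self a (b ∷ [])) (cong suc (count-∷-other [] (a≢b ∘ sym))) ,
    trans (count-∷-other (b ∷ []) a≢b) (count-∷-self b [])

  count-pair^ : ∀ {a b : Fin n} → a ≢ b → ∀ j →
                      count a ((a ∷ b ∷ []) ^ j) ≡ j × count b ((a ∷ b ∷ []) ^ j) ≡ j
  count-pair^ {a} {b} a≢b j =
    trans (count-^ a _ j) (trans (cong (j *_) (proj₁ (count-pair a≢b))) (*-identityʳ j)) ,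
    trans (count-^ b _ j) (trans (cong (j *_) (proj₂ (count-pair a≢b))) (*-identityʳ j))

  count-pair^-∷ʳ : ∀ {a b : Fin n} → a ≢ b → ∀ j →
                   count a ((a ∷ b ∷ []) ^ j ++ [ a ]) ≡ suc j × count b ((a ∷ b ∷ []) ^ j ++ [ a ]) ≡ j
  count-pair^-∷ʳ {a} {b} a≢b j =
    trans (count-++ a ((a ∷ b ∷ []) ^ j) [ a ])
          (trans (cong₂ _+_ (proj₁ (count-pair^ a≢b j)) (count-∷-self a [])) (+-comm j 1)) ,
    trans (count-++ b ((a ∷ b ∷ []) ^ j) [ a ])
          (trans (cong₂ _+_ (proj₂ (count-pair^ a≢b j)) (count-∷-other [] a≢b)) (+-identityʳ j))

  head-count-≥ : ∀ {a b : Fin n} t → a ≢ b → Binary a b (a ∷ t) → NoRepeat (a ∷ t) →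
                  count b (a ∷ t) ≤ count a (a ∷ t)
  head-count-≥ {a} {b} t a≢b bin nr with alternation-shape t bin nr
  ... | j , inj₁ e with ca , cb ← count-pair^-∷ʳ a≢b j =
    subst (λ s → count b s ≤ count a s) (sym e) (subst₂ _≤_ (sym cb) (sym ca) (n≤1+n j))
  ... | j , inj₂ e with ca , cb ← count-pair^ a≢b (suc j) =
    subst (λ s → count b s ≤ count a s) (sym e) (subst₂ _≤_ (sym cb) (sym ca) ≤-refl)

  balanced-shape : ∀ {a b : Fin n} t → a ≢ b → Binary a b (a ∷ t) → NoRepeat (a ∷ t) →
                   count a (a ∷ t) ≡ count b (a ∷ t) → ∃ λ j → a ∷ t ≡ (a ∷ b ∷ []) ^ j
  balanced-shape {a} {b} t a≢b bin nr balanced with alternation-shape t bin nr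
  ... | j , inj₂ e = suc j , e
  ... | j , inj₁ e with ca , cb ← count-pair^-∷ʳ a≢b j =
    ⊥-elim (1+n≢n (trans (sym ca) (trans (subst (λ s → count a s ≡ count b s) e balanced) cb)))

  majority-starts : ∀ {a b : Fin n} s → a ≢ b → Binary a b s → NoRepeat s → count a s < count b s →
                    StartsWith b s
  majority-starts (_ ∷ t) a≢b (inj₂ refl ∷ _) nr a<b = t , refl
  majority-starts (_ ∷ t) a≢b bin@(inj₁ refl ∷ _) nr a<b = ⊥-elim (<⇒≱ a<b (head-count-≥ t a≢b bin nr))

  noRepeat-pair^ : ∀ {a b : Fin n} → a ≢ b → ∀ j → NoRepeat ((a ∷ b ∷ []) ^ j)
  noRepeat-pair^ {a} {b} a≢b zero    = nr-[]
  noRepeat-pair^ {a} {b} a≢b (suc j) = nr-∷ a≢b (noRepeat-b∷ j)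
    where
    noRepeat-b∷ : ∀ j → NoRepeat (b ∷ (a ∷ b ∷ []) ^ j)
    noRepeat-b∷ zero    = nr-[ b ]
    noRepeat-b∷ (suc j) = nr-∷ (a≢b ∘ sym) (nr-∷ a≢b (noRepeat-b∷ j))

  pair^-∷ʳ : ∀ (a b : Fin n) j → (a ∷ b ∷ []) ^ j ++ [ a ] ≡ a ∷ (b ∷ a ∷ []) ^ j
  pair^-∷ʳ a b zero    = refl
  pair^-∷ʳ a b (suc j) = cong (λ s → a ∷ b ∷ s) (pair^-∷ʳ a b j)

  Alternating : Word n → Set
  Alternating s = ∃₂ λ a b → a ≢ b × ∃ λ j → s ≡ (a ∷ b ∷ []) ^ j

  alternating⇒noRepeat : ∀ {s} → Alternating s → NoRepeat s
  alternating⇒noRepeat (a , b , a≢b , j , refl) = noRepeat-pair^ a≢b j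

  alternating-rotate₁ : ∀ {s} → Alternating s → Alternating (rotate₁ s)
  alternating-rotate₁ (a , b , a≢b , zero  , refl) = a , b , a≢b , 0 , refl
  alternating-rotate₁ (a , b , a≢b , suc j , refl) =
    b , a , a≢b ∘ sym , suc j , cong (b ∷_) (pair^-∷ʳ a b j)

  alternating-^ : ∀ {s} m → Alternating s → Alternating (s ^ m)
  alternating-^ m (a , b , a≢b , j , refl) = a , b , a≢b , m * j , ^-* (a ∷ b ∷ []) j m

  balanced⇒alternating : ∀ {p q : Fin n} s → p ≢ q → Binary p q s → count p s ≡ count q s →
                         NoRepeat s → Alternating s
  balanced⇒alternating {p} {q} [] p≢q _ _ _ = p , q , p≢q , 0 , refl
  balanced⇒alternating {p} {q} (_ ∷ t) p≢q bin@(inj₁ refl ∷ _) balanced nr =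
    p , q , p≢q , balanced-shape t p≢q bin nr balanced
  balanced⇒alternating {p} {q} (_ ∷ t) p≢q bin@(inj₂ refl ∷ _) balanced nr =
    q , p , p≢q ∘ sym , balanced-shape t (p≢q ∘ sym) (All.map Sum.swap bin) nr (sym balanced)

  uniform-restrict-alternating : ∀ {p q : Fin n} w → Uniform w → p ≢ q → NoRepeat (restrict p q w) →
                        Alternating (restrict p q w)
  uniform-restrict-alternating {p} {q} w uniform p≢q =
    balanced⇒alternating (restrict p q w) p≢q (binary-restrict p q w)
      (trans (count-restrict w (inj₁ refl)) (trans (uniform p q) (sym (count-restrict w (inj₂ refl)))))

  noRepeat-restrict-rotate₁ : ∀ {p q : Fin n} w → Uniform w → p ≢ q →
                              NoRepeat (restrict p q w) → NoRepeat (restrict p q (rotate₁ w))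
  noRepeat-restrict-rotate₁ {p} {q} w uniform p≢q nr with restrict-rotate₁ p q w
  ... | inj₂ unchanged = subst NoRepeat (sym unchanged) nr
  ... | inj₁ rotated   = subst NoRepeat (sym rotated)
                           (alternating⇒noRepeat (alternating-rotate₁ (uniform-restrict-alternating w uniform p≢q nr)))

  uniform-↭ : ∀ {u v} → u ↭ v → Uniform u → Uniform v
  uniform-↭ u↭v uniform x y = trans (sym (count-↭ x u↭v)) (trans (uniform x y) (count-↭ y u↭v))

  noRepeat-restrict-rotate : ∀ {p q : Fin n} k w → Uniform w → p ≢ q →
                             NoRepeat (restrict p q w) → NoRepeat (restrict p q (rotate k w))
  noRepeat-restrict-rotate zero    w uniform p≢q nr = nr
  noRepeat-restrict-rotate (suc k) w uniform p≢q nr =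
    noRepeat-restrict-rotate k (rotate₁ w) (uniform-↭ (↭-sym (rotate-↭ 1 w)) uniform) p≢q
      (noRepeat-restrict-rotate₁ w uniform p≢q nr)

  noRepeat-restrict-rotate₁⁻ : ∀ {p q : Fin n} w → Uniform w → p ≢ q →
                               NoRepeat (restrict p q (rotate₁ w)) → NoRepeat (restrict p q w)
  noRepeat-restrict-rotate₁⁻ []       uniform p≢q nr = nr
  noRepeat-restrict-rotate₁⁻ {p} {q} (x ∷ xs) uniform p≢q nr =
    subst (λ v → NoRepeat (restrict p q v)) (rotate-++ xs [ x ])
      (noRepeat-restrict-rotate (length xs) (xs ++ [ x ]) (uniform-↭ (↭-sym (rotate-↭ 1 (x ∷ xs))) uniform) p≢q nr)

  lastFirstOccurrence : ∀ {ℓ} {P : Pred (Fin n) ℓ} → Decidable P → ∀ w → (∀ z → P z → z ∈ w) → ∃ P →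
                ∃ λ x → P x × ∀ y → P y → y ≢ x → StartsWith y (restrict x y w)
  lastFirstOccurrence P? [] occurs (z , pz) with () ← occurs z pz
  lastFirstOccurrence {P = P} P? (c ∷ w) occurs sat with P? c
  ... | no ¬pc
    with x , px , latest ← lastFirstOccurrence P? w (λ z pz → tail (λ { refl → ¬pc pz }) (occurs z pz)) sat =
    x , px , λ y py y≢x → let t , e = latest y py y≢x in t , trans (restrict-reject w (c∉ px py)) e
    where
    c∉ : ∀ {x y} → P x → P y → ¬ (c ≡ x ⊎ c ≡ y)
    c∉ px py (inj₁ refl) = ¬pc px
    c∉ px py (inj₂ refl) = ¬pc py
  ... | yes pc with any? (λ z → P? z ×-dec ¬? (z ≟ c))
  ...   | no none = c , pc , λ y py y≢c → ⊥-elim (none (y , py , y≢c))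
  ...   | yes other with x , (px , x≢c) , latest ← lastFirstOccurrence (λ z → P? z ×-dec ¬? (z ≟ c)) w
                                                   (λ z (pz , z≢c) → tail z≢c (occurs z pz)) other =
    x , px , starts
    where
    starts : ∀ y → P y → y ≢ x → StartsWith y (restrict x y (c ∷ w))
    starts y py y≢x with y ≟ c
    ... | yes refl = restrict x c w , restrict-accept w (inj₂ refl)
    ... | no y≢c = let t , e = latest y (py , y≢c) y≢x in
      t , trans (restrict-reject w (λ { (inj₁ c≡x) → x≢c (sym c≡x) ; (inj₂ c≡y) → y≢c (sym c≡y) })) e

  deficit : ℕ → Word n → ℕ
  deficit K w = sum (λ z → K ∸ count z w)

  deficit-∷ : ∀ K {x} w → count x w < K → deficit K w ≡ suc (deficit K (x ∷ w))
  deficit-∷ K {x} w x<K = sum-suc-at _ _ x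
    (trans (+-∸-assoc 1 x<K) (cong (λ c → suc (K ∸ c)) (sym (count-∷-self x w))))
    (λ z z≢x → cong (K ∸_) (sym (count-∷-other w (z≢x ∘ sym))))

module _ {n : ℕ} where

  private
    module Lex = DecTotalOrder (≤-decTotalOrder (<-strictTotalOrder n))
    open Data.List.Extrema Lex.totalOrder using (argmin; f[argmin]≤f[xs])

  infix 4 _≼_
  _≼_ : Word n → Word n → Set
  _≼_ = Lex._≤_

  []≼ : ∀ w → [] ≼ w
  []≼ []      = base tt
  []≼ (_ ∷ _) = halt

  ≼-antisym : ∀ {u v} → u ≼ v → v ≼ u → u ≡ v
  ≼-antisym u≼v v≼u = Pointwise-≡⇒≡ (Lex.antisym u≼v v≼u)

  ≼-cancelˡ : ∀ u {a b} → u ++ a ≼ u ++ b → a ≼ b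
  ≼-cancelˡ []      a≼b            = a≼b
  ≼-cancelˡ (c ∷ u) (this c<c)     = ⊥-elim (<-irrefl refl c<c)
  ≼-cancelˡ (c ∷ u) (next _ ua≼ub) = ≼-cancelˡ u ua≼ub

  ≼-prefix : ∀ (x y : Word n) {a b} → length x ≡ length y → x ++ a ≼ y ++ b → x ≼ y
  ≼-prefix []      []      _       _                  = base tt
  ≼-prefix (_ ∷ x) (_ ∷ y) _       (this c<d)         = this c<d
  ≼-prefix (_ ∷ x) (_ ∷ y) |x|≡|y| (next c≡d xa≼yb) = next c≡d (≼-prefix x y (suc-injective |x|≡|y|) xa≼yb)

  IsLeastRotation : Word n → Set
  IsLeastRotation r = ∀ k → r ≼ rotate k r

  leastRotation : ∀ w → ∃ λ k → IsLeastRotation (rotate k w)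
  leastRotation []          = 0 , λ k → []≼ (rotate k [])
  leastRotation w@(_ ∷ _) =
    k , λ j → subst (rotate k w ≼_) (sym (rotation j)) (minimal (∈-upTo⁺ (m%n<n (k + j) (length w))))
    where
    k = argmin (λ i → rotate i w) 0 (upTo (length w))
    minimal = All.lookup (f[argmin]≤f[xs] {f = λ i → rotate i w} 0 (upTo (length w)))
    rotation : ∀ j → rotate j (rotate k w) ≡ rotate ((k + j) % length w) w
    rotation j = trans (sym (rotate-+ k j w)) (rotate-% (k + j) w)

  Periodic : Word n → Set
  Periodic r = ∃ λ t → t < length r × 0 < t × rotate t r ≡ r

  -- If r = uvu, comparing r with its rotations vuu and uuv gives uv ≼ vu ≼ uv, so r has period |uv|.
  leastRotation⇒borderFree : ∀ r → IsLeastRotation r → ¬ Periodic r → BorderFree r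
  leastRotation⇒borderFree _ least aperiodic (u , v , u≢[] , refl) =
    aperiodic (length (u ++ v) , shorter , positive , period)
    where
    uv≼vu : u ++ v ≼ v ++ u
    uv≼vu = ≼-prefix (u ++ v) (v ++ u) (length-++-comm u v)
      (subst₂ _≼_ (sym (++-assoc u v u)) (rotate-++ u (v ++ u)) (least (length u)))
    vu≼uv : v ++ u ≼ u ++ v
    vu≼uv = ≼-cancelˡ u (subst (u ++ v ++ u ≼_) rotated (least (length (u ++ v))))
      where
      rotated : rotate (length (u ++ v)) (u ++ v ++ u) ≡ u ++ u ++ v
      rotated = trans (cong (rotate (length (u ++ v))) (sym (++-assoc u v u))) (rotate-++ (u ++ v) u)
    period : rotate (length (u ++ v)) (u ++ v ++ u) ≡ u ++ v ++ u
    period = trans (cong (rotate (length (u ++ v))) (sym (++-assoc u v u)))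
               (trans (rotate-++ (u ++ v) u) (cong (u ++_) (≼-antisym uv≼vu vu≼uv)))
    positive : 0 < length (u ++ v)
    positive = ≤-trans (≢[]⇒0<length u u≢[]) (subst (length u ≤_) (sym (length-++ u)) (m≤m+n (length u) (length v)))
    shorter : length (u ++ v) < length (u ++ v ++ u)
    shorter = subst (length (u ++ v) <_) (trans (sym (length-++ (u ++ v))) (cong length (++-assoc u v u)))
                (m<m+n (length (u ++ v)) (≢[]⇒0<length u u≢[]))

  periodic⇒root : ∀ {r} → Periodic r → ∃₂ λ z m → r ≡ z ^ suc m × length z < length r
  periodic⇒root {r} (t , t<|r| , 0<t , fixed) = root (++-comm⇒^ p q pq≡qp p≢[])
    where
    p = take t r
    q = drop t r
    |p|≡t : length p ≡ t
    |p|≡t = trans (length-take t r) (m≤n⇒m⊓n≡m (<⇒≤ t<|r|))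
    pq≡qp : p ++ q ≡ q ++ p
    pq≡qp = begin
      p ++ q                     ≡⟨ take++drop≡id t r ⟩
      r                          ≡⟨ fixed ⟨
      rotate t r                 ≡⟨ cong₂ rotate (sym |p|≡t) (sym (take++drop≡id t r)) ⟩
      rotate (length p) (p ++ q) ≡⟨ rotate-++ p q ⟩
      q ++ p                     ∎
      where open ≡-Reasoning
    p≢[] : p ≢ []
    p≢[] p≡[] with () ← subst (0 <_) (trans (sym |p|≡t) (cong length p≡[])) 0<t
    q≢[] : q ≢ []
    q≢[] q≡[] = m>n⇒m∸n≢0 t<|r| (trans (sym (length-drop t r)) (cong length q≡[]))
    root : (∃₂ λ z i → ∃ λ j → p ≡ z ^ suc i × q ≡ z ^ j) →
           ∃₂ λ z m → r ≡ z ^ suc m × length z < length r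
    root (_ , _ , zero  , _    , q≡[]) = ⊥-elim (q≢[] q≡[])
    root (z , i , suc j , p≡zⁱ , q≡zʲ) =
      z , i + suc j ,
      trans (sym (take++drop≡id t r)) (trans (cong₂ _++_ p≡zⁱ q≡zʲ) (sym (^-+ z (suc i) (suc j)))) ,
      ≤-<-trans |z|≤|p| (subst (_< length r) (sym |p|≡t) t<|r|)
      where
      |z|≤|p| : length z ≤ length p
      |z|≤|p| = subst (λ s → length z ≤ length s) (sym p≡zⁱ)
                  (subst (length z ≤_) (sym (length-++ z)) (m≤m+n (length z) _))

  periodic? : ∀ (r : Word n) → Dec (Periodic r)
  periodic? r = anyUpTo? (λ t → (1 ≤? t) ×-dec ≡-dec _≟_ (rotate t r) r) (length r)

module _ {n : ℕ} (G : Graph n) where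
  open Graph G using (Edge; irrefl) renaming (sym to Edge-sym)

  represents-cong : ∀ {w w′} → Represents G w → (∀ x → x ∈ w′) →
                    (∀ {p q} → p ≢ q → NoRepeat (restrict p q w) → NoRepeat (restrict p q w′)) →
                    (∀ {p q} → p ≢ q → NoRepeat (restrict p q w′) → NoRepeat (restrict p q w)) →
                    Represents G w′
  represents-cong (_ , alternation) occurs′ to from = occurs′ , λ p q p≢q →
    (λ (_ , nr) → proj₁ (alternation p q p≢q) (p≢q , from p≢q nr)) ,
    (λ pq → p≢q , to p≢q (proj₂ (proj₂ (alternation p q p≢q) pq)))

  represents-∷ : ∀ {w} x → Represents G w → (∀ y → Edge x y → StartsWith y (restrict x y w)) →
                 Represents G (x ∷ w)
  represents-∷ {w} x (occurs , alternation) starts = (λ z → there (occurs z)) , λ p q p≢q →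
    (λ (_ , nr) → proj₁ (alternation p q p≢q) (p≢q , forget p q nr)) ,
    (λ pq → p≢q , extend p q p≢q pq (proj₂ (proj₂ (alternation p q p≢q) pq)))
    where
    forget : ∀ p q → NoRepeat (restrict p q (x ∷ w)) → NoRepeat (restrict p q w)
    forget p q nr with (x ≟ p) ⊎-dec (x ≟ q)
    ... | yes x∈ = noRepeat-tail (subst NoRepeat (restrict-accept w x∈) nr)
    ... | no  x∉ = subst NoRepeat (restrict-reject w x∉) nr
    extend : ∀ p q → p ≢ q → Edge p q → NoRepeat (restrict p q w) → NoRepeat (restrict p q (x ∷ w))
    extend p q p≢q pq nr with (x ≟ p) ⊎-dec (x ≟ q)
    ... | no x∉ = subst NoRepeat (sym (restrict-reject w x∉)) nr
    ... | yes (inj₁ refl) with t , e ← starts q pq =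
      subst NoRepeat (sym (trans (restrict-accept w (inj₁ refl)) (cong (x ∷_) e)))
        (nr-∷ p≢q (subst NoRepeat e nr))
    ... | yes (inj₂ refl) with t , e ← starts p (Edge-sym pq) =
      subst NoRepeat (sym (trans (restrict-accept w (inj₂ refl)) (cong (x ∷_) e′)))
        (nr-∷ (p≢q ∘ sym) (subst NoRepeat e′ nr))
      where e′ = trans (restrict-comm p x w) e

  UniformRep : Word n → Set
  UniformRep w = Represents G w × Uniform w

  uniformRep-rotate₁ : ∀ w → UniformRep w → UniformRep (rotate₁ w)
  uniformRep-rotate₁ w (rep , uniform) =
    represents-cong rep (λ x → ∈-resp-↭ (↭-sym (rotate-↭ 1 w)) (proj₁ rep x))
      (noRepeat-restrict-rotate₁ w uniform) (noRepeat-restrict-rotate₁⁻ w uniform) ,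
    uniform-↭ (↭-sym (rotate-↭ 1 w)) uniform

  uniformRep-rotate : ∀ k w → UniformRep w → UniformRep (rotate k w)
  uniformRep-rotate zero    w ur = ur
  uniformRep-rotate (suc k) w ur = uniformRep-rotate k (rotate₁ w) (uniformRep-rotate₁ w ur)

  uniformRep-root : ∀ z m → UniformRep (z ^ suc m) → UniformRep z
  uniformRep-root z m (rep , uniform) =
    represents-cong rep (λ x → ∈-^ z (suc m) (proj₁ rep x)) to from , uniformᶻ
    where
    uniformᶻ : Uniform z
    uniformᶻ x y = *-cancelˡ-≡ (count x z) (count y z) (suc m)
      (trans (sym (count-^ x z (suc m))) (trans (uniform x y) (count-^ y z (suc m))))
    to : ∀ {p q} → p ≢ q → NoRepeat (restrict p q (z ^ suc m)) → NoRepeat (restrict p q z)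
    to {p} {q} _ nr = noRepeat-++ˡ (restrict p q z) (subst NoRepeat (restrict-^ p q z (suc m)) nr)
    from : ∀ {p q} → p ≢ q → NoRepeat (restrict p q z) → NoRepeat (restrict p q (z ^ suc m))
    from {p} {q} p≢q nr = subst NoRepeat (sym (restrict-^ p q z (suc m)))
      (alternating⇒noRepeat (alternating-^ (suc m) (uniform-restrict-alternating z uniformᶻ p≢q nr)))

  -- Prepend the letter x below K whose first occurrence comes last: for each neighbour y
  -- of x the restriction to {x, y} then starts with y, since y either occurs before x's
  -- first occurrence or outnumbers x.
  uniformise : ∀ K w → Represents G w → (∀ z → count z w ≤ K) → Acc _<_ (deficit K w) → ∃ UniformRep
  uniformise K w rep ≤K (acc rec) with any? (λ z → count z w <? K)
  ... | no none = w , rep , λ x y → trans (full x) (sym (full y))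
    where
    full : ∀ z → count z w ≡ K
    full z = ≤-antisym (≤K z) (≮⇒≥ (λ z<K → none (z , z<K)))
  ... | yes below with x , x<K , latest ← lastFirstOccurrence (λ z → count z w <? K) w (λ z _ → proj₁ rep z) below =
    uniformise K (x ∷ w) (represents-∷ x rep starts) ≤K′ (rec (≤-reflexive (sym (deficit-∷ K w x<K))))
    where
    starts : ∀ y → Edge x y → StartsWith y (restrict x y w)
    starts y xy with count y w <? K
    ... | yes y<K = latest y y<K (λ { refl → irrefl xy })
    ... | no  y≮K = majority-starts (restrict x y w) x≢y (binary-restrict x y w)
                      (proj₂ (proj₂ (proj₂ rep x y x≢y) xy))
                      (subst₂ _<_ (sym (count-restrict w (inj₁ refl))) (sym (count-restrict w (inj₂ refl)))
                         (<-≤-trans x<K (≮⇒≥ y≮K)))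
      where
      x≢y : x ≢ y
      x≢y refl = irrefl xy
    ≤K′ : ∀ z → count z (x ∷ w) ≤ K
    ≤K′ z with z ≟ x
    ... | yes refl = subst (_≤ K) (sym (count-∷-self x w)) x<K
    ... | no  z≢x  = subst (_≤ K) (sym (count-∷-other w (z≢x ∘ sym))) (≤K z)

  uniformRepresentative : ∀ {w} → Represents G w → ∃ UniformRep
  uniformRepresentative {w} rep =
    uniformise (length w) w rep (λ z → length-filter (_≟ z) w) (<-wellFounded (deficit (length w) w))

  borderFree-representative : ∀ w → UniformRep w → Σ (Word n) (λ w′ → BorderFree w′ × Represents G w′)
  borderFree-representative w = go w (<-wellFounded (length w))
    where
    go : ∀ w → Acc _<_ (length w) → UniformRep w → Σ (Word n) (λ w′ → BorderFree w′ × Represents G w′)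
    go w (acc rec) ur with k , least ← leastRotation w | periodic? (rotate k w)
    ... | no aperiodic =
      rotate k w , leastRotation⇒borderFree (rotate k w) least aperiodic , proj₁ (uniformRep-rotate k w ur)
    ... | yes periodic with z , m , r≡zᵐ , shorter ← periodic⇒root periodic =
      go z (rec (subst (length z <_) (↭-length (rotate-↭ k w)) shorter))
        (uniformRep-root z m (subst UniformRep r≡zᵐ (uniformRep-rotate k w ur)))

mainTheorem1 : ∀ (n : ℕ) (G : Graph n) → WordRepresentable G →
    Σ (Word n) (λ w → BorderFree w × Represents G w)
mainTheorem1 n G (w , rep) =
  let w₁ , uniformRep = uniformRepresentative G rep
  in  borderFree-representative G w₁ uniformRep
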